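{- Let $W=w_1w_2\dots$ be an infinite word over a finite alphabet $S$ that is not ultimately periodic. Let $e\ge 0$ and $M\ge 1$ be integers. Then there exist words $U,V$ of length $e$ over $S$, letters $s,s',t,t'\in S$, and congruence classes $\bar m,\bar n$ modulo $M$ such that $s\neq s'$, $t\neq t'$, the words $sU$ and $s'U$ both occur in $W$ at infinitely many positions in $\bar m$, and the words $Vt$ and $Vt'$ both occur in $W$ at infinitely many positions in $\bar n$.
   Context: A word $v_1\dots v_e$ occurs in $w_1w_2\dots$ at position $n$ if $w_{n+i-1}=v_i$ for all $1\le i\le e$. An infinite word is ultimately periodic if there exist $p\ge1$ and $n_0$ with $w_{k+p}=w_k$ for all $k\ge n_0$. -}

module Defs where

open import Data.Nat using (ℕ; zero; suc; _+_; _∸_; _≤_; NonZero)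
open import Data.Nat.DivMod using (_mod_)
open import Data.Fin using (Fin; toℕ)
open import Data.Vec using (Vec; lookup)
open import Data.Product using (Σ; ∃; _×_)
open import Relation.Binary.PropositionalEquality using (_≡_)

-- An infinite word w₁w₂… over S is represented as  W : ℕ → S  with  W k = w_{k+1}.
InfWord : Set → Set
InfWord S = ℕ → S

UltimatelyPeriodic : {S : Set} → InfWord S → Set
UltimatelyPeriodic W =
  Σ ℕ λ p → (1 ≤ p) × (Σ ℕ λ n₀ → (k : ℕ) → n₀ ≤ k → W (k + p) ≡ W k)

OccursAt : {S : Set} {e : ℕ} → Vec S e → InfWord S → ℕ → Set
OccursAt {e = e} v W n = (1 ≤ n) × ((i : Fin e) → W (n ∸ 1 + toℕ i) ≡ lookup v i)

OccursInfinitelyOftenIn : {S : Set} {e : ℕ} → Vec S e → InfWord S →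
                          (M : ℕ) .{{_ : NonZero M}} → Fin M → Set
OccursInfinitelyOftenIn v W M m =
  (N : ℕ) → Σ ℕ λ n → (N ≤ n) × (n mod M ≡ m) × OccursAt v W n

{-# OPTIONS --safe #-}

-- Give each position the code (its residue mod M, the factor of length e + 1 starting there).
-- By excluded middle, every code that occurs late enough occurs infinitely often. Hence if no
-- factor of length e is right special (in a common residue class), from some point on the code of
-- a position determines the code of the next one, and pigeonhole on the finitely many codes makes
-- W ultimately periodic. If none is left special, each code determines the previous one; then,
-- with K the number of codes, a repetition found beyond n + K ! propagates back to n with a period
-- p ≤ K, and p ∣ K ! gives the uniform period K !.
module Submission where

open import Defs
open import Level using (0ℓ)
open import Axiom.ExcludedMiddle using (ExcludedMiddle)
open import Axiom.DoubleNegationElimination using (em⇒dne)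
open import Data.Nat using (ℕ; zero; suc; pred; _+_; _*_; _∸_; _^_; _⊔_; _!; _%_; _≤_; _≤′_; _≤‴_; z≤n; s≤s; s≤s⁻¹; NonZero)
open import Data.Nat.Base using (≤′-refl; ≤′-step; ≤‴-refl; ≤‴-step)
open import Data.Nat.Properties
open import Data.Nat.DivMod using (_mod_; m%n<n; %-distribˡ-+; [m+n]%n≡m%n)
open import Data.Nat.Divisibility using (_∣_; m∣m*n; ∣-trans; m≤n⇒m!∣n!)
open import Data.Fin using (Fin; zero; suc; toℕ; combine)
open import Data.Fin.Properties using (pigeonhole; toℕ<n; toℕ-fromℕ<; fromℕ<-cong; combine-injective; *↔×)
open import Data.Vec using (Vec; []; _∷_; _∷ʳ_; head; lookup)
open import Data.Vec.Properties using (∷-injectiveʳ; ∷ʳ-injectiveˡ)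
open import Data.Product using (Σ; ∃; _×_; _,_; proj₁; proj₂; map₂)
open import Data.Product.Properties using (,-injectiveˡ; ,-injectiveʳ)
open import Data.Product.Function.NonDependent.Propositional using (_×-↣_)
open import Data.Empty using (⊥-elim)
open import Function using (_∘_)
open import Function.Bundles using (_↔_; _↣_; Injection; mk↣)
open import Function.Construct.Composition using (_↣-∘_)
open import Function.Construct.Identity using (↣-id)
open import Function.Definitions using (Injective)
open import Function.Properties.Inverse using (↔-sym; ↔⇒↣)
open import Relation.Nullary using (¬_; yes; no)
open import Relation.Binary.PropositionalEquality
  using (_≡_; _≢_; refl; sym; trans; cong; cong₂; subst; subst₂; module ≡-Reasoning)

finite-bounded : ∀ {K} (f : Fin K → ℕ) → ∃ λ B → ∀ i → f i ≤ B
finite-bounded {zero}  f = 0 , λ ()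
finite-bounded {suc K} f with finite-bounded (f ∘ suc)
... | B , f∘suc≤B = f zero ⊔ B , λ
  { zero    → m≤m⊔n (f zero) B
  ; (suc i) → m≤n⇒m≤o⊔n (f zero) (f∘suc≤B i)
  }

m≤n⇒m∣n! : ∀ {m n} → 1 ≤ m → m ≤ n → m ∣ n !
m≤n⇒m∣n! {suc m} _ 1+m≤n = ∣-trans (m∣m*n (m !)) (m≤n⇒m!∣n! 1+m≤n)

Vec↣ : ∀ {A : Set} {k} n → A ↣ Fin k → Vec A n ↣ Fin (k ^ n)
Vec↣ {A} {k} n A↣Fin = mk↣ encode-injective
  where
  open Injection A↣Fin using (to; injective)

  encode : ∀ {n} → Vec A n → Fin (k ^ n)
  encode []       = zero
  encode (x ∷ xs) = combine (to x) (encode xs)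

  encode-injective : ∀ {n} → Injective _≡_ _≡_ (encode {n})
  encode-injective {x = []}     {[]}     _  = refl
  encode-injective {x = x ∷ xs} {y ∷ ys} eq
    with combine-injective (to x) (encode xs) (to y) (encode ys) eq
  ... | x≡y , xs≡ys = cong₂ _∷_ (injective x≡y) (encode-injective xs≡ys)

module _ {A : Set} where

  ultimatelyPeriodic-∘ : ∀ {B : Set} {c : ℕ → A} (f : A → B) →
                         UltimatelyPeriodic c → UltimatelyPeriodic (f ∘ c)
  ultimatelyPeriodic-∘ f (p , 1≤p , n₀ , periodic) = p , 1≤p , n₀ , λ k n₀≤k → cong f (periodic k n₀≤k)

  Recurrent : (ℕ → A) → A → Set
  Recurrent c v = ∀ N → ∃ λ m → N ≤ m × c m ≡ v

  ForwardDeterministicFrom : ℕ → (ℕ → A) → Set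
  ForwardDeterministicFrom N₀ c = ∀ {a b} → N₀ ≤ a → N₀ ≤ b → c a ≡ c b → c (suc a) ≡ c (suc b)

  BackwardDeterministicFrom : ℕ → (ℕ → A) → Set
  BackwardDeterministicFrom N₀ c = ∀ {a b} → N₀ ≤ a → N₀ ≤ b → c (suc a) ≡ c (suc b) → c a ≡ c b

  recurrenceThreshold : ExcludedMiddle 0ℓ → (c : ℕ → A) (v : A) →
                        ∃ λ B → ∀ n → B ≤ n → c n ≡ v → Recurrent c v
  recurrenceThreshold em c v with em {∃ λ B → ∀ n → B ≤ n → c n ≢ v}
  ... | yes (B , absent) = B , λ n B≤n cn≡v → ⊥-elim (absent n B≤n cn≡v)
  ... | no ¬absent       = 0 , λ _ _ _ N → em⇒dne em λ ¬found →
                             ¬absent (N , λ n N≤n cn≡v → ¬found (n , N≤n , cn≡v))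

module FiniteSequence {A : Set} {K : ℕ} (A↣Fin : A ↣ Fin K) (c : ℕ → A) where
  open Injection A↣Fin using (injective) renaming (to to encode)

  record Repetition (n : ℕ) : Set where
    field
      start    : ℕ
      period   : ℕ
      n≤start  : n ≤ start
      1≤period : 1 ≤ period
      period≤K : period ≤ K
      repeats  : c (start + period) ≡ c start

  repetitionFrom : ∀ n → Repetition n
  repetitionFrom n with pigeonhole (n<1+n K) (λ i → encode (c (n + toℕ i)))
  ... | i , j , i<j , same = record
    { start    = n + toℕ i
    ; period   = toℕ j ∸ toℕ i
    ; n≤start  = m≤m+n n (toℕ i)
    ; 1≤period = m<n⇒0<n∸m i<j
    ; period≤K = ≤-trans (m∸n≤m (toℕ j) (toℕ i)) (s≤s⁻¹ (toℕ<n j))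
    ; repeats  = trans (cong c start+period≡) (sym (injective same))
    }
    where
    start+period≡ : n + toℕ i + (toℕ j ∸ toℕ i) ≡ n + toℕ j
    start+period≡ = trans (+-assoc n (toℕ i) _) (cong (n +_) (m+[n∸m]≡n (<⇒≤ i<j)))

  eventuallyRecurrent : ExcludedMiddle 0ℓ → ∃ λ N₀ → ∀ n → N₀ ≤ n → Recurrent c (c n)
  eventuallyRecurrent em with finite-bounded (λ i → proj₁ (recurrenceThreshold em (encode ∘ c) i))
  ... | N₀ , threshold≤N₀ = N₀ , λ n N₀≤n N → map₂ (map₂ injective) (recurrent n N₀≤n N)
    where
    recurrent : ∀ n → N₀ ≤ n → Recurrent (encode ∘ c) (encode (c n))
    recurrent n N₀≤n = proj₂ (recurrenceThreshold em (encode ∘ c) (encode (c n))) n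
                         (≤-trans (threshold≤N₀ (encode (c n))) N₀≤n) refl

  forwardDeterministic⇒ultimatelyPeriodic : ∀ N₀ → ForwardDeterministicFrom N₀ c → UltimatelyPeriodic c
  forwardDeterministic⇒ultimatelyPeriodic N₀ step =
    period , 1≤period , start , λ x start≤x → periodic (≤⇒≤′ start≤x)
    where
    open Repetition (repetitionFrom N₀)
    periodic : ∀ {x} → start ≤′ x → c (x + period) ≡ c x
    periodic ≤′-refl = repeats
    periodic {suc x} (≤′-step start≤x) =
      step (≤-trans N₀≤x (m≤m+n x period)) N₀≤x (periodic start≤x)
      where N₀≤x = ≤-trans n≤start (≤′⇒≤ start≤x)

  backwardDeterministic⇒ultimatelyPeriodic : ∀ N₀ → BackwardDeterministicFrom N₀ c → UltimatelyPeriodic c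
  backwardDeterministic⇒ultimatelyPeriodic N₀ step = K ! , 1≤n! K , N₀ , periodic
    where
    periodic : ∀ n → N₀ ≤ n → c (n + K !) ≡ c n
    periodic n N₀≤n = begin
      c (n + K !)               ≡⟨ cong (λ m → c (n + m)) equality ⟩
      c (n + quotient * period) ≡⟨ multiple quotient N₀≤n
                                     (subst (λ m → n + m ≤ start) equality n≤start) ⟩
      c n                       ∎
      where
      open ≡-Reasoning
      open Repetition (repetitionFrom (n + K !))
      open _∣_ (m≤n⇒m∣n! 1≤period period≤K)

      back : ∀ {x} → N₀ ≤ x → x ≤‴ start → c (x + period) ≡ c x
      back _ ≤‴-refl = repeats
      back {x} N₀≤x (≤‴-step x<start) =
        step N₀≤x+period N₀≤x (back (m≤n⇒m≤1+n N₀≤x) x<start)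
        where N₀≤x+period = ≤-trans N₀≤x (m≤m+n x period)

      multiple : ∀ q {x} → N₀ ≤ x → x + q * period ≤ start → c (x + q * period) ≡ c x
      multiple zero    {x} _ _ = cong c (+-identityʳ x)
      multiple (suc q) {x} N₀≤x bound = begin
        c (x + (period + q * period)) ≡⟨ cong c (+-assoc x period (q * period)) ⟨
        c (x + period + q * period)   ≡⟨ multiple q (≤-trans N₀≤x (m≤m+n x period)) bound′ ⟩
        c (x + period)                ≡⟨ back N₀≤x (≤⇒≤‴ (≤-trans (m≤m+n x _) bound)) ⟩
        c x                           ∎
        where
        bound′ = subst (_≤ start) (sym (+-assoc x period (q * period))) bound

module _ (M : ℕ) .{{_ : NonZero M}} where

  mod≡⇒%≡ : ∀ {a b} → a mod M ≡ b mod M → a % M ≡ b % M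
  mod≡⇒%≡ {a} {b} eq =
    trans (sym (toℕ-fromℕ< (m%n<n a M))) (trans (cong toℕ eq) (toℕ-fromℕ< (m%n<n b M)))

  %≡⇒mod≡ : ∀ {a b} → a % M ≡ b % M → a mod M ≡ b mod M
  %≡⇒mod≡ {a} {b} eq = fromℕ<-cong _ _ eq (m%n<n a M) (m%n<n b M)

  %-cong-+ˡ : ∀ n {a b} → a % M ≡ b % M → (n + a) % M ≡ (n + b) % M
  %-cong-+ˡ n {a} {b} eq = begin
    (n + a) % M             ≡⟨ %-distribˡ-+ n a M ⟩
    (n % M + a % M) % M     ≡⟨ cong (λ r → (n % M + r) % M) eq ⟩
    (n % M + b % M) % M     ≡⟨ %-distribˡ-+ n b M ⟨
    (n + b) % M             ∎
    where open ≡-Reasoning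

  [pred[M]+suc[a]]%M≡a%M : ∀ a → (pred M + suc a) % M ≡ a % M
  [pred[M]+suc[a]]%M≡a%M a = begin
    (pred M + suc a) % M   ≡⟨ cong (_% M) (+-suc (pred M) a) ⟩
    (suc (pred M) + a) % M ≡⟨ cong (λ m → (m + a) % M) (suc-pred M) ⟩
    (M + a) % M            ≡⟨ cong (_% M) (+-comm M a) ⟩
    (a + M) % M            ≡⟨ [m+n]%n≡m%n a M ⟩
    a % M                  ∎
    where open ≡-Reasoning

  mod-cong-suc : ∀ {a b} → a mod M ≡ b mod M → suc a mod M ≡ suc b mod M
  mod-cong-suc eq = %≡⇒mod≡ (%-cong-+ˡ 1 (mod≡⇒%≡ eq))

  mod-cancel-suc : ∀ {a b} → suc a mod M ≡ suc b mod M → a mod M ≡ b mod M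
  mod-cancel-suc {a} {b} eq = %≡⇒mod≡ (begin
    a % M                ≡⟨ [pred[M]+suc[a]]%M≡a%M a ⟨
    (pred M + suc a) % M ≡⟨ %-cong-+ˡ (pred M) (mod≡⇒%≡ eq) ⟩
    (pred M + suc b) % M ≡⟨ [pred[M]+suc[a]]%M≡a%M b ⟩
    b % M                ∎)
    where open ≡-Reasoning

module _ {S : Set} (W : InfWord S) where

  window : ∀ l → ℕ → Vec S l
  window zero    a = []
  window (suc l) a = W a ∷ window l (suc a)

  window-∷ʳ : ∀ l a → window (suc l) a ≡ window l a ∷ʳ W (a + l)
  window-∷ʳ zero    a = cong (λ x → W x ∷ []) (sym (+-identityʳ a))
  window-∷ʳ (suc l) a = cong (W a ∷_) (trans (window-∷ʳ l (suc a))
                                             (cong (λ x → window l (suc a) ∷ʳ W x) (sym (+-suc a l))))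

  occursAt-window : ∀ l a → OccursAt (window l a) W (suc a)
  occursAt-window l a = s≤s z≤n , lookup-window l a
    where
    lookup-window : ∀ l a (i : Fin l) → W (a + toℕ i) ≡ lookup (window l a) i
    lookup-window (suc l) a zero    = cong W (+-identityʳ a)
    lookup-window (suc l) a (suc i) = trans (cong W (+-suc a (toℕ i))) (lookup-window l (suc a) i)

module _ (em : ExcludedMiddle 0ℓ) {S : Set} {k : ℕ} (S↔Fin : S ↔ Fin k) (W : InfWord S)
         (e M : ℕ) .{{_ : NonZero M}} where

  LeftSpecial : Set
  LeftSpecial = Σ (Vec S e) λ U → Σ S λ s → Σ S λ s′ → Σ (Fin M) λ m̄ →
    (s ≢ s′) × OccursInfinitelyOftenIn (s ∷ U) W M m̄ × OccursInfinitelyOftenIn (s′ ∷ U) W M m̄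

  RightSpecial : Set
  RightSpecial = Σ (Vec S e) λ V → Σ S λ t → Σ S λ t′ → Σ (Fin M) λ n̄ →
    (t ≢ t′) × OccursInfinitelyOftenIn (V ∷ʳ t) W M n̄ × OccursInfinitelyOftenIn (V ∷ʳ t′) W M n̄

  -- W a is the letter at the 1-based position suc a.
  class : ℕ → Fin M
  class a = suc a mod M

  Code : Set
  Code = Fin M × Vec S (suc e)

  code : ℕ → Code
  code a = class a , window W (suc e) a

  Code↣Fin : Code ↣ Fin (M * k ^ suc e)
  Code↣Fin = ↔⇒↣ (↔-sym *↔×) ↣-∘ (↣-id _ ×-↣ Vec↣ (suc e) (↔⇒↣ S↔Fin))

  open FiniteSequence Code↣Fin code

  N₀ : ℕ
  N₀ = proj₁ (eventuallyRecurrent em)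

  window-occursInfinitelyOften : ∀ {a} → N₀ ≤ a →
                                 OccursInfinitelyOftenIn (window W (suc e) a) W M (class a)
  window-occursInfinitelyOften {a} N₀≤a N with proj₂ (eventuallyRecurrent em) a N₀≤a N
  ... | m , N≤m , same = suc m , m≤n⇒m≤1+n N≤m , ,-injectiveˡ same ,
                         subst (λ v → OccursAt v W (suc m)) (,-injectiveʳ same)
                               (occursAt-window W (suc e) m)

  ¬leftSpecial⇒leftDeterministic : ¬ LeftSpecial → ∀ {a b} → N₀ ≤ a → N₀ ≤ b → class a ≡ class b →
                                   window W e (suc a) ≡ window W e (suc b) → W a ≡ W b
  ¬leftSpecial⇒leftDeterministic ¬special {a} {b} N₀≤a N₀≤b class≡ window≡ = em⇒dne em λ Wa≢Wb →
    ¬special (window W e (suc a) , W a , W b , class a , Wa≢Wb ,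
              window-occursInfinitelyOften N₀≤a ,
              subst₂ (λ v → OccursInfinitelyOftenIn v W M) (cong (W b ∷_) (sym window≡)) (sym class≡)
                     (window-occursInfinitelyOften N₀≤b))

  ¬rightSpecial⇒rightDeterministic : ¬ RightSpecial → ∀ {a b} → N₀ ≤ a → N₀ ≤ b → class a ≡ class b →
                                     window W e a ≡ window W e b → W (a + e) ≡ W (b + e)
  ¬rightSpecial⇒rightDeterministic ¬special {a} {b} N₀≤a N₀≤b class≡ window≡ = em⇒dne em λ Wa≢Wb →
    ¬special (window W e a , W (a + e) , W (b + e) , class a , Wa≢Wb ,
              subst (λ v → OccursInfinitelyOftenIn v W M (class a)) (window-∷ʳ W e a)
                    (window-occursInfinitelyOften N₀≤a) ,
              subst₂ (λ v → OccursInfinitelyOftenIn v W M)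
                     (trans (window-∷ʳ W e b) (cong (_∷ʳ W (b + e)) (sym window≡))) (sym class≡)
                     (window-occursInfinitelyOften N₀≤b))

  ¬rightSpecial⇒forwardDeterministic : ¬ RightSpecial → ForwardDeterministicFrom N₀ code
  ¬rightSpecial⇒forwardDeterministic ¬special {a} {b} N₀≤a N₀≤b same =
    cong₂ _,_ class≡ (begin
      window W (suc e) (suc a)               ≡⟨ window-∷ʳ W e (suc a) ⟩
      window W e (suc a) ∷ʳ W (suc a + e)    ≡⟨ cong₂ _∷ʳ_ window≡ last≡ ⟩
      window W e (suc b) ∷ʳ W (suc b + e)    ≡⟨ window-∷ʳ W e (suc b) ⟨
      window W (suc e) (suc b)               ∎)
    where
    open ≡-Reasoning
    class≡ = mod-cong-suc M (,-injectiveˡ same)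
    window≡ = ∷-injectiveʳ (,-injectiveʳ same)
    last≡ = ¬rightSpecial⇒rightDeterministic ¬special (m≤n⇒m≤1+n N₀≤a) (m≤n⇒m≤1+n N₀≤b) class≡ window≡

  ¬leftSpecial⇒backwardDeterministic : ¬ LeftSpecial → BackwardDeterministicFrom N₀ code
  ¬leftSpecial⇒backwardDeterministic ¬special {a} {b} N₀≤a N₀≤b same =
    cong₂ _,_ class≡ (cong₂ _∷_ (¬leftSpecial⇒leftDeterministic ¬special N₀≤a N₀≤b class≡ window≡) window≡)
    where
    class≡ = mod-cancel-suc M (,-injectiveˡ same)
    window≡ = ∷ʳ-injectiveˡ _ _ (begin
      window W e (suc a) ∷ʳ W (suc a + e) ≡⟨ window-∷ʳ W e (suc a) ⟨
      window W (suc e) (suc a)            ≡⟨ ,-injectiveʳ same ⟩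
      window W (suc e) (suc b)            ≡⟨ window-∷ʳ W e (suc b) ⟩
      window W e (suc b) ∷ʳ W (suc b + e) ∎)
      where open ≡-Reasoning

  leftSpecial : ¬ UltimatelyPeriodic W → LeftSpecial
  leftSpecial aperiodic = em⇒dne em λ ¬special → aperiodic (ultimatelyPeriodic-∘ (head ∘ proj₂)
    (backwardDeterministic⇒ultimatelyPeriodic N₀ (¬leftSpecial⇒backwardDeterministic ¬special)))

  rightSpecial : ¬ UltimatelyPeriodic W → RightSpecial
  rightSpecial aperiodic = em⇒dne em λ ¬special → aperiodic (ultimatelyPeriodic-∘ (head ∘ proj₂)
    (forwardDeterministic⇒ultimatelyPeriodic N₀ (¬rightSpecial⇒forwardDeterministic ¬special)))

lemma3p2 : ExcludedMiddle 0ℓ →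
    (S : Set) → (Σ ℕ λ k → S ↔ Fin k) →
    (W : InfWord S) → ¬ UltimatelyPeriodic W →
    (e M : ℕ) → .{{_ : NonZero M}} →
    Σ (Vec S e) λ U → Σ (Vec S e) λ V →
    Σ S λ s → Σ S λ s′ → Σ S λ t → Σ S λ t′ →
    Σ (Fin M) λ m̄ → Σ (Fin M) λ n̄ →
      (s ≢ s′) × (t ≢ t′) ×
      OccursInfinitelyOftenIn (s ∷ U) W M m̄ ×
      OccursInfinitelyOftenIn (s′ ∷ U) W M m̄ ×
      OccursInfinitelyOftenIn (V ∷ʳ t) W M n̄ ×
      OccursInfinitelyOftenIn (V ∷ʳ t′) W M n̄
lemma3p2 em S (k , S↔Fin) W aperiodic e M
  with leftSpecial em S↔Fin W e M aperiodic | rightSpecial em S↔Fin W e M aperiodic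
... | U , s , s′ , m̄ , s≢s′ , sU , s′U | V , t , t′ , n̄ , t≢t′ , Vt , Vt′ =
  U , V , s , s′ , t , t′ , m̄ , n̄ , s≢s′ , t≢t′ , sU , s′U , Vt , Vt′
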